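{- For every applicability condition $C$, $\mathrm{sneg}(\mathrm{sneg}(\mathrm{sneg}(C)))=\mathrm{sneg}(C)$. Consequently, $\mathrm{sneg}^{2n+1}=\mathrm{sneg}$ and $\mathrm{sneg}^{2n}=\mathrm{sneg}^2$ for $n=1,2,\ldots$.
   Context: An applicability condition is a first-order formula in negation normal form (negation $\neg$ applied only to atomic formulas; other connectives $\wedge,\vee,\exists,\forall$). Its atomic formulas are either pure atomic formulas (comparisons of elements of a defeasible theory, arithmetic and set comparisons, containing no tagged literal) or proof atomic formulas $+d\,p\in X$ or $-d\,p\in X$, where $d$ is a tag, $p$ a literal, and $X$ is either the current proof $P$ or a pre-defined set of conclusions; $c\notin X$ abbreviates $\neg(c\in X)$. The strong negation $\mathrm{sneg}$ is defined inductively: $\mathrm{sneg}(+d p\in X)= -dp\in X$; $\mathrm{sneg}(-dp\in X)=+dp\in X$; $\mathrm{sneg}(+dp\notin X)=+dp\in X$; $\mathrm{sneg}(-dp\notin X)=-dp\in X$; $\mathrm{sneg}(A\wedge B)=\mathrm{sneg}(A)\vee\mathrm{sneg}(B)$; $\mathrm{sneg}(A\vee B)=\mathrm{sneg}(A)\wedge\mathrm{sneg}(B)$; $\mathrm{sneg}(\exists x\,A)=\forall x\,\mathrm{sneg}(A)$; $\mathrm{sneg}(\forall x\,A)=\exists x\,\mathrm{sneg}(A)$; $\mathrm{sneg}(\neg A)=A$ and $\mathrm{sneg}(A)=\neg A$ for a pure atomic formula $A$. -}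

module Defs where

open import Data.Nat using (ℕ; zero; suc)

-- Sign of a tagged literal: +d p or -d p
data Sign : Set where
  plus minus : Sign

flip : Sign → Sign
flip plus  = minus
flip minus = plus

-- Applicability conditions in negation normal form.
-- Parameters (abstract syntax of the underlying theory):
--   Pure : pure atomic formulas (comparisons etc., possibly with free variables)
--   Tag  : proof tags d
--   Lit  : literals p
--   Conc : the sets X (the current proof P or a pre-defined set of conclusions)
--   Var  : variables bound by quantifiers
data Cond (Pure Tag Lit Conc Var : Set) : Set where
  pure   : Pure → Cond Pure Tag Lit Conc Var
  ¬pure  : Pure → Cond Pure Tag Lit Conc Var
  inP    : Sign → Tag → Lit → Conc → Cond Pure Tag Lit Conc Var   -- ±d p ∈ X
  notinP : Sign → Tag → Lit → Conc → Cond Pure Tag Lit Conc Var   -- ±d p ∉ X  (= ¬(±d p ∈ X))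
  _∧′_   : Cond Pure Tag Lit Conc Var → Cond Pure Tag Lit Conc Var → Cond Pure Tag Lit Conc Var
  _∨′_   : Cond Pure Tag Lit Conc Var → Cond Pure Tag Lit Conc Var → Cond Pure Tag Lit Conc Var
  ∃′     : Var → Cond Pure Tag Lit Conc Var → Cond Pure Tag Lit Conc Var
  ∀′     : Var → Cond Pure Tag Lit Conc Var → Cond Pure Tag Lit Conc Var

module _ {Pure Tag Lit Conc Var : Set} where

  sneg : Cond Pure Tag Lit Conc Var → Cond Pure Tag Lit Conc Var
  sneg (pure A)          = ¬pure A
  sneg (¬pure A)         = pure A
  sneg (inP s d p X)     = inP (flip s) d p X
  sneg (notinP s d p X)  = inP s d p X
  sneg (A ∧′ B)          = sneg A ∨′ sneg B
  sneg (A ∨′ B)          = sneg A ∧′ sneg B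
  sneg (∃′ x A)          = ∀′ x (sneg A)
  sneg (∀′ x A)          = ∃′ x (sneg A)

  sneg^ : ℕ → Cond Pure Tag Lit Conc Var → Cond Pure Tag Lit Conc Var
  sneg^ zero    C = C
  sneg^ (suc n) C = sneg (sneg^ n C)

{-# OPTIONS --safe #-}
-- Strong negation maps every condition to a ∉-free one, and on ∉-free
-- conditions it is an involution. Hence sneg ∘ sneg fixes each sneg C, so any
-- even number of further negations leaves sneg C unchanged.
module Submission where

open import Defs
open import Data.Nat using (ℕ; _+_; _*_; _≤_; suc; s≤s; z≤n)
open import Data.Nat.Properties using (*-suc; +-comm)
open import Data.Product using (_×_; _,_)
open import Relation.Binary.PropositionalEquality
  using (_≡_; refl; cong; cong₂; module ≡-Reasoning)
open ≡-Reasoning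

flip-involutive : ∀ s → flip (flip s) ≡ s
flip-involutive plus  = refl
flip-involutive minus = refl

module _ {Pure Tag Lit Conc Var : Set} where

  sneg³≡sneg : (C : Cond Pure Tag Lit Conc Var) → sneg (sneg (sneg C)) ≡ sneg C
  sneg³≡sneg (pure A)         = refl
  sneg³≡sneg (¬pure A)        = refl
  sneg³≡sneg (inP s d p X)    = cong (λ t → inP t d p X) (cong flip (flip-involutive s))
  sneg³≡sneg (notinP s d p X) = cong (λ t → inP t d p X) (flip-involutive s)
  sneg³≡sneg (A ∧′ B)         = cong₂ _∨′_ (sneg³≡sneg A) (sneg³≡sneg B)
  sneg³≡sneg (A ∨′ B)         = cong₂ _∧′_ (sneg³≡sneg A) (sneg³≡sneg B)
  sneg³≡sneg (∃′ x A)         = cong (∀′ x) (sneg³≡sneg A)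
  sneg³≡sneg (∀′ x A)         = cong (∃′ x) (sneg³≡sneg A)

  sneg^-+ : ∀ m n (C : Cond Pure Tag Lit Conc Var) →
            sneg^ (m + n) C ≡ sneg^ m (sneg^ n C)
  sneg^-+ 0       n C = refl
  sneg^-+ (suc m) n C = cong sneg (sneg^-+ m n C)

  sneg^-2*-sneg : ∀ n (C : Cond Pure Tag Lit Conc Var) →
                  sneg^ (2 * n) (sneg C) ≡ sneg C
  sneg^-2*-sneg 0       C = refl
  sneg^-2*-sneg (suc n) C = begin
    sneg^ (2 * suc n) (sneg C)              ≡⟨ cong (λ k → sneg^ k (sneg C)) (*-suc 2 n) ⟩
    sneg^ (2 + 2 * n) (sneg C)              ≡⟨ sneg^-+ 2 (2 * n) (sneg C) ⟩
    sneg (sneg (sneg^ (2 * n) (sneg C)))    ≡⟨ cong (λ D → sneg (sneg D)) (sneg^-2*-sneg n C) ⟩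
    sneg (sneg (sneg C))                    ≡⟨ sneg³≡sneg C ⟩
    sneg C                                  ∎

  sneg^-odd : ∀ n (C : Cond Pure Tag Lit Conc Var) → sneg^ (2 * n + 1) C ≡ sneg C
  sneg^-odd n C = begin
    sneg^ (2 * n + 1) C         ≡⟨ sneg^-+ (2 * n) 1 C ⟩
    sneg^ (2 * n) (sneg C)      ≡⟨ sneg^-2*-sneg n C ⟩
    sneg C                      ∎

  sneg^-even : ∀ {n} → 1 ≤ n → (C : Cond Pure Tag Lit Conc Var) →
               sneg^ (2 * n) C ≡ sneg^ 2 C
  sneg^-even {suc n} (s≤s z≤n) C = begin
    sneg^ (2 * suc n) C             ≡⟨ cong (λ k → sneg^ k C) (*-suc 2 n) ⟩
    sneg^ (2 + 2 * n) C             ≡⟨ cong (λ k → sneg^ k C) (+-comm 2 (2 * n)) ⟩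
    sneg^ (2 * n + 2) C             ≡⟨ sneg^-+ (2 * n) 2 C ⟩
    sneg^ (2 * n) (sneg (sneg C))   ≡⟨ sneg^-2*-sneg n (sneg C) ⟩
    sneg (sneg C)                   ∎

  proposition5 :
    ((C : Cond Pure Tag Lit Conc Var) → sneg (sneg (sneg C)) ≡ sneg C)
    × ((n : ℕ) → 1 ≤ n → (C : Cond Pure Tag Lit Conc Var) →
    (sneg^ (2 * n + 1) C ≡ sneg C) × (sneg^ (2 * n) C ≡ sneg^ 2 C))
  proposition5 = sneg³≡sneg , λ n 1≤n C → sneg^-odd n C , sneg^-even 1≤n C
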